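{- Let $G=(V,E)$ be a finite simple graph with $E\neq\emptyset$ and let $p$ be a positive integer. If $\gamma_p(G)>p$, then $r_p(G)=\eta_p(G)$.
   Context: For $x\in V$, $N_G(x)$ is the set of neighbours of $x$. A set $D\subseteq V$ is a $p$-dominating set if every vertex $x\notin D$ satisfies $|N_G(x)\cap D|\ge p$; $\gamma_p(G)$ is the minimum size of a $p$-dominating set. $G^c$ denotes the complement of $G$, and for $B\subseteq E(G^c)$, $G+B$ is the graph $(V,E\cup B)$. The $p$-reinforcement number is $r_p(G)=\min\{|B| : B\subseteq E(G^c),\ \gamma_p(G+B)<\gamma_p(G)\}$, with the convention $r_p(G)=0$ if $\gamma_p(G)\le p$. For $X\subseteq V$ and $x\in V$, define $\eta_p(x,X,G)=p-|N_G(x)\cap X|$ if $x\notin X$ and $|N_G(x)\cap X|<p$, and $\eta_p(x,X,G)=0$ otherwise. Define $\eta_p(G)=\min\{\sum_{x\in V}\eta_p(x,X,G) : X\subseteq V,\ |X|<\gamma_p(G)\}$. -}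

module Defs where

open import Data.Nat using (ℕ; zero; suc; _+_; _∸_; _⊓_; _≤_; _<_; _≤ᵇ_; _<ᵇ_; _*_)
open import Data.Nat.ListAction using (sum)
open import Data.Bool using (Bool; true; false; _∨_; _∧_; not; if_then_else_)
open import Data.Fin using (Fin; toℕ)
open import Data.Fin.Subset using (Subset; ∣_∣; _∩_)
open import Data.Vec using (Vec; []; _∷_; lookup; tabulate)
open import Data.List using (List; []; _∷_; _++_; map; foldr; filterᵇ; allFin; length; cartesianProduct)
open import Data.Bool.ListAction using (and)
open import Data.Product using (Σ; ∃; ∃-syntax; _×_; _,_)
open import Relation.Binary.PropositionalEquality using (_≡_)

Adj : ℕ → Set
Adj n = Fin n → Fin n → Bool

record Graph (n : ℕ) : Set where
  field
    adj   : Adj n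
    sym   : ∀ x y → adj x y ≡ adj y x
    irrefl : ∀ x → adj x x ≡ false
open Graph public

HasEdge : ∀ {n} → Graph n → Set
HasEdge G = ∃[ x ] ∃[ y ] (adj G x y ≡ true)

allSubsets : ∀ n → List (Subset n)
allSubsets zero = [] ∷ []
allSubsets (suc n) = map (true ∷_) (allSubsets n) ++ map (false ∷_) (allSubsets n)

nbhd : ∀ {n} → Adj n → Fin n → Subset n
nbhd a x = tabulate (a x)

degIn : ∀ {n} → Adj n → Fin n → Subset n → ℕ
degIn a x X = ∣ nbhd a x ∩ X ∣

isPDom : ∀ {n} → ℕ → Adj n → Subset n → Bool
isPDom p a D = and (map (λ x → lookup D x ∨ (p ≤ᵇ degIn a x D)) (allFin _))

minimumOr : ℕ → List ℕ → ℕ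
minimumOr d [] = d
minimumOr d (x ∷ xs) = foldr _⊓_ x xs

-- γ_p(G): minimum size of a p-dominating set (V itself is always one, so the list is nonempty)
gammaP : ∀ {n} → ℕ → Adj n → ℕ
gammaP {n} p a = minimumOr n (map ∣_∣ (filterᵇ (isPDom p a) (allSubsets n)))

-- η_p(x,X,G): p - |N(x) ∩ X| if x ∉ X and |N(x) ∩ X| < p, else 0
-- (truncated subtraction gives 0 exactly when |N(x) ∩ X| ≥ p)
etaPt : ∀ {n} → ℕ → Adj n → Fin n → Subset n → ℕ
etaPt p a x X = if lookup X x then 0 else p ∸ degIn a x X

etaSum : ∀ {n} → ℕ → Adj n → Subset n → ℕ
etaSum p a X = sum (map (λ x → etaPt p a x X) (allFin _))

-- η_p(G) = min { Σ_x η_p(x,X,G) : |X| < γ_p(G) }   (default n*p = value at X = ∅)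
etaP : ∀ {n} → ℕ → Adj n → ℕ
etaP {n} p a =
  minimumOr (n * p)
    (map (etaSum p a) (filterᵇ (λ X → suc ∣ X ∣ ≤ᵇ gammaP p a) (allSubsets n)))

record NonEdgeSet {n} (G : Graph n) : Set where
  field
    badj     : Adj n
    bsym     : ∀ x y → badj x y ≡ badj y x
    birrefl  : ∀ x → badj x x ≡ false
    disjoint : ∀ x y → badj x y ≡ true → adj G x y ≡ false
open NonEdgeSet public

edgeCount : ∀ {n} → Adj n → ℕ
edgeCount {n} b = length (filterᵇ (λ xy → f xy) (cartesianProduct (allFin n) (allFin n)))
  where
    f : Fin n × Fin n → Bool
    f (x , y) = (toℕ x <ᵇ toℕ y) ∧ b x y

plus : ∀ {n} (G : Graph n) → NonEdgeSet G → Adj n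
plus G B x y = adj G x y ∨ badj B x y

Reinforces : ∀ {n} → ℕ → (G : Graph n) → NonEdgeSet G → Set
Reinforces p G B = gammaP p (plus G B) < gammaP p (adj G)

IsReinforcementNumber : ∀ {n} → ℕ → Graph n → ℕ → Set
IsReinforcementNumber p G k =
  (Σ (NonEdgeSet G) λ B → Reinforces p G B × edgeCount (badj B) ≡ k)
  × (∀ (B : NonEdgeSet G) → Reinforces p G B → k ≤ edgeCount (badj B))

module Submission where

-- Lower bound.  Let B reinforce G and let D be a minimum p-dominating set of
-- G + B, so |D| < γ_p(G).  Every x ∉ D misses at most η_p(x,D,G) neighbours in
-- D in G, and these must be supplied by B-edges from x into D; distinct such
-- pairs are distinct edges of B, hence η_p(G) ≤ Σ_x η_p(x,D,G) ≤ |B|.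
--
-- Upper bound.  Take X attaining η_p(G) and enlarge it (which can only lower
-- the deficiency Σ_x η_p(x,X,G)) to size max(p,|X|) < γ_p(G).  While some
-- x ∉ X has fewer than p neighbours in X, it has a non-neighbour y ∈ X because
-- |X| ≥ p; adding the edge xy lowers the deficiency by one.  The edges added
-- until the deficiency vanishes make X p-dominating, so they reinforce G.

open import Defs hiding (sym)
open import Data.Nat using (ℕ; zero; suc; _+_; _*_; _∸_; _⊓_; _⊔_; _≤_; _<_; _≤ᵇ_; _<ᵇ_; z≤n; s≤s; s≤s⁻¹; z<s)
open import Data.Nat.Properties hiding (_≟_)
open import Data.Nat.ListAction using () renaming (sum to sumˡ)
open import Data.Nat.ListAction.Properties using (sum-++)
open import Data.Bool using (Bool; true; false; _∨_; _∧_; not; T)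
open import Data.Bool.Properties using (T-≡; T-∧; T-∨; ∨-comm; ∨-assoc; ∨-zeroʳ; ∧-comm; ∧-zeroʳ)
open import Data.Bool.ListAction using (and)
open import Data.Fin using (Fin; zero; suc; toℕ)
open import Data.Fin.Properties using (_≟_; toℕ-injective)
open import Data.Fin.Subset using (Subset; ∣_∣; _∩_; ⊤; ⊥)
open import Data.Fin.Subset.Properties using (∣⊤∣≡n; ∣⊥∣≡0; ∣p∣≤n)
open import Data.Vec using ([]; _∷_; lookup; tabulate)
open import Data.Vec.Properties using (lookup-replicate)
import Data.List as List
open import Data.List using (List; []; _∷_; map; filterᵇ; allFin; length; cartesianProduct)
open import Data.List.Properties using (map-++; map-∘; map-tabulate; foldr-preservesᵒ)
open import Data.List.Relation.Unary.Any as Any using (here; there)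
open import Data.List.Membership.Propositional using (_∈_)
open import Data.List.Membership.Propositional.Properties
  using (∈-map⁺; ∈-map⁻; ∈-filter⁺; ∈-filter⁻; ∈-++⁺ˡ; ∈-++⁺ʳ; foldr-selective)
open import Data.Product using (Σ; ∃-syntax; _×_; _,_; proj₂)
open import Data.Sum using (_⊎_; inj₁; inj₂; [_,_])
import Data.Sum as Sum
open import Relation.Nullary using (does; yes; no; contradiction)
open import Relation.Nullary.Decidable using (T?; dec-true; dec-false)
open import Relation.Binary.Definitions using (tri<; tri≈; tri>)
open import Relation.Binary.PropositionalEquality using (_≡_; _≢_; refl; sym; trans; cong; cong₂; subst; subst₂; module ≡-Reasoning)
open import Function using (_∘_; id; Equivalence)
open import Algebra.Properties.CommutativeMonoid.Sum +-0-commutativeMonoid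
  using (sum; sum-syntax; sum-cong-≗; ∑-distrib-+; ∑-comm; sum-replicate-zero)

-- Finite sums of natural numbers over Fin n

ind : Bool → ℕ
ind true  = 1
ind false = 0

sum-mono : ∀ {n} {f g : Fin n → ℕ} → (∀ i → f i ≤ g i) → sum f ≤ sum g
sum-mono {zero}  f≤g = z≤n
sum-mono {suc n} f≤g = +-mono-≤ (f≤g zero) (sum-mono (f≤g ∘ suc))

sum-mono-< : ∀ {n} {f g : Fin n → ℕ} → (∀ i → f i ≤ g i) → ∀ j → f j < g j → sum f < sum g
sum-mono-< f≤g zero    fj<gj = +-mono-<-≤ fj<gj (sum-mono (f≤g ∘ suc))
sum-mono-< f≤g (suc j) fj<gj = +-mono-≤-< (f≤g zero) (sum-mono-< (f≤g ∘ suc) j fj<gj)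

sum-<⇒∃ : ∀ {n} (f g : Fin n → ℕ) → sum f < sum g → ∃[ i ] f i < g i
sum-<⇒∃ {suc n} f g Σf<Σg with f zero <? g zero
... | yes f₀<g₀ = zero , f₀<g₀
... | no  f₀≮g₀ = let i , fi<gi = sum-<⇒∃ (f ∘ suc) (g ∘ suc) Σf'<Σg' in suc i , fi<gi
  where
  Σf'<Σg' : sum (f ∘ suc) < sum (g ∘ suc)
  Σf'<Σg' = +-cancelˡ-< (g zero) _ _ (≤-<-trans (+-monoˡ-≤ _ (≮⇒≥ f₀≮g₀)) Σf<Σg)

summand≤sum : ∀ {n} (f : Fin n → ℕ) i → f i ≤ sum f
summand≤sum f zero    = m≤m+n (f zero) _
summand≤sum f (suc i) = ≤-trans (summand≤sum (f ∘ suc) i) (m≤n+m _ (f zero))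

feq : ∀ {n} → Fin n → Fin n → Bool
feq u x = does (u ≟ x)

feq-sound : ∀ {n} {u x : Fin n} → feq u x ≡ true → u ≡ x
feq-sound {u = u} {x} u≟x with u ≟ x | u≟x
... | yes u≡x | _ = u≡x

sum-δ : ∀ {n} (x : Fin n) → ∑[ u < n ] ind (feq u x) ≡ 1
sum-δ {suc n} zero    = cong suc (sum-replicate-zero n)
sum-δ {suc n} (suc x) = sum-δ x

sumˡ-tabulate : ∀ {n} (f : Fin n → ℕ) → sumˡ (List.tabulate f) ≡ sum f
sumˡ-tabulate {zero}  f = refl
sumˡ-tabulate {suc n} f = cong (f zero +_) (sumˡ-tabulate (f ∘ suc))

sumˡ-allFin : ∀ {n} (f : Fin n → ℕ) → sumˡ (map f (allFin n)) ≡ sum f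
sumˡ-allFin f = trans (cong sumˡ (map-tabulate id f)) (sumˡ-tabulate f)

length-filterᵇ : ∀ {A : Set} (P : A → Bool) (xs : List A) →
  length (filterᵇ P xs) ≡ sumˡ (map (ind ∘ P) xs)
length-filterᵇ P []       = refl
length-filterᵇ P (x ∷ xs) with P x
... | true  = cong suc (length-filterᵇ P xs)
... | false = length-filterᵇ P xs

sumˡ-cartesianProduct : ∀ {A B : Set} (g : A × B → ℕ) (xs : List A) (ys : List B) →
  sumˡ (map g (cartesianProduct xs ys)) ≡ sumˡ (map (λ x → sumˡ (map (λ y → g (x , y)) ys)) xs)
sumˡ-cartesianProduct g []       ys = refl
sumˡ-cartesianProduct g (x ∷ xs) ys = begin
  sumˡ (map g (map (x ,_) ys List.++ cartesianProduct xs ys))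
    ≡⟨ cong sumˡ (map-++ g (map (x ,_) ys) _) ⟩
  sumˡ (map g (map (x ,_) ys) List.++ map g (cartesianProduct xs ys))
    ≡⟨ sum-++ (map g (map (x ,_) ys)) _ ⟩
  sumˡ (map g (map (x ,_) ys)) + sumˡ (map g (cartesianProduct xs ys))
    ≡⟨ cong₂ _+_ (cong sumˡ (sym (map-∘ ys))) (sumˡ-cartesianProduct g xs ys) ⟩
  sumˡ (map (λ y → g (x , y)) ys) + sumˡ (map (λ x → sumˡ (map (λ y → g (x , y)) ys)) xs) ∎
  where open ≡-Reasoning

card-sum : ∀ {n} (X : Subset n) → ∣ X ∣ ≡ ∑[ i < n ] ind (lookup X i)
card-sum []          = refl
card-sum (true ∷ X)  = cong suc (card-sum X)
card-sum (false ∷ X) = card-sum X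

deg-sum : ∀ {n} (a : Adj n) x (X : Subset n) → degIn a x X ≡ ∑[ y < n ] ind (a x y ∧ lookup X y)
deg-sum a x X = count-∩ (a x) X
  where
  count-∩ : ∀ {m} (f : Fin m → Bool) (Y : Subset m) → ∣ tabulate f ∩ Y ∣ ≡ ∑[ y < m ] ind (f y ∧ lookup Y y)
  count-∩ f []      = refl
  count-∩ f (b ∷ Y) with f zero | b
  ... | true  | true  = cong suc (count-∩ (f ∘ suc) Y)
  ... | true  | false = count-∩ (f ∘ suc) Y
  ... | false | _     = count-∩ (f ∘ suc) Y

etaSum-sum : ∀ {n} p (a : Adj n) X → etaSum p a X ≡ ∑[ x < n ] etaPt p a x X
etaSum-sum p a X = sumˡ-allFin (λ x → etaPt p a x X)

-- p-domination and the minima γ_p and η_p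

Dominates : ∀ {n} → ℕ → Adj n → Subset n → Set
Dominates p a X = ∀ x → lookup X x ≡ false → p ≤ degIn a x X

and-tabulate⁻ : ∀ {n} (f : Fin n → Bool) → and (List.tabulate f) ≡ true → ∀ i → f i ≡ true
and-tabulate⁻ {suc n} f h i with f zero in f₀≡
and-tabulate⁻ {suc n} f h zero    | true = f₀≡
and-tabulate⁻ {suc n} f h (suc i) | true = and-tabulate⁻ (f ∘ suc) h i

and-tabulate⁺ : ∀ {n} (f : Fin n → Bool) → (∀ i → f i ≡ true) → and (List.tabulate f) ≡ true
and-tabulate⁺ {zero}  f h = refl
and-tabulate⁺ {suc n} f h rewrite h zero = and-tabulate⁺ (f ∘ suc) (h ∘ suc)

module _ {n} (p : ℕ) (a : Adj n) (D : Subset n) where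
  private
    test : Fin n → Bool
    test x = lookup D x ∨ (p ≤ᵇ degIn a x D)

    isPDom≡ : isPDom p a D ≡ and (List.tabulate test)
    isPDom≡ = cong and (map-tabulate id test)

  isPDom-sound : isPDom p a D ≡ true → Dominates p a D
  isPDom-sound h x x∉D with and-tabulate⁻ test (trans (sym isPDom≡) h) x
  ... | p≤ᵇdeg rewrite x∉D = ≤ᵇ⇒≤ p _ (Equivalence.from T-≡ p≤ᵇdeg)

  isPDom-complete : Dominates p a D → isPDom p a D ≡ true
  isPDom-complete dom = trans isPDom≡ (and-tabulate⁺ test passes)
    where
    passes : ∀ x → test x ≡ true
    passes x with lookup D x in x∈?D
    ... | true  = refl
    ... | false = Equivalence.to T-≡ (≤⇒≤ᵇ (dom x x∈?D))

minimumOr-≤ : ∀ d {xs : List ℕ} {v} → v ∈ xs → minimumOr d xs ≤ v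
minimumOr-≤ d {x ∷ xs} {v} v∈ = foldr-preservesᵒ {P = _≤ v} ⊓-preserves x xs (located v∈)
  where
  ⊓-preserves : ∀ m k → m ≤ v ⊎ k ≤ v → m ⊓ k ≤ v
  ⊓-preserves m k = [ m≤n⇒m⊓o≤n k , m≤n⇒o⊓m≤n m ]
  located : v ∈ x ∷ xs → x ≤ v ⊎ Any.Any (_≤ v) xs
  located (here v≡x)  = inj₁ (≤-reflexive (sym v≡x))
  located (there v∈') = inj₂ (Any.map (λ v≡y → ≤-reflexive (sym v≡y)) v∈')

minimumOr-∈ : ∀ d {xs : List ℕ} {v} → v ∈ xs → minimumOr d xs ∈ xs
minimumOr-∈ d {x ∷ xs} _ with foldr-selective {_•_ = _⊓_} ⊓-sel x xs
... | inj₁ min≡x  = here min≡x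
... | inj₂ min∈xs = there min∈xs

allSubsets-complete : ∀ {n} (X : Subset n) → X ∈ allSubsets n
allSubsets-complete []          = here refl
allSubsets-complete (true ∷ X)  = ∈-++⁺ˡ (∈-map⁺ (true ∷_) (allSubsets-complete X))
allSubsets-complete {suc n} (false ∷ X) =
  ∈-++⁺ʳ (map (true ∷_) (allSubsets n)) (∈-map⁺ (false ∷_) (allSubsets-complete X))

minOver : ∀ {n} → ℕ → (Subset n → Bool) → (Subset n → ℕ) → ℕ
minOver {n} d P w = minimumOr d (map w (filterᵇ P (allSubsets n)))

module _ {n} (d : ℕ) (P : Subset n → Bool) (w : Subset n → ℕ) where
  private
    candidate : ∀ X → P X ≡ true → X ∈ filterᵇ P (allSubsets n)
    candidate X PX = ∈-filter⁺ (T? ∘ P) (allSubsets-complete X) (Equivalence.from T-≡ PX)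

  minOver-≤ : ∀ X → P X ≡ true → minOver d P w ≤ w X
  minOver-≤ X PX = minimumOr-≤ d (∈-map⁺ w (candidate X PX))

  minOver-attained : ∀ X → P X ≡ true → ∃[ Y ] P Y ≡ true × minOver d P w ≡ w Y
  minOver-attained X PX with ∈-map⁻ w (minimumOr-∈ d (∈-map⁺ w (candidate X PX)))
  ... | Y , Y∈ , min≡wY = Y , Equivalence.to T-≡ (proj₂ (∈-filter⁻ (T? ∘ P) {xs = allSubsets n} Y∈)) , min≡wY

module _ {n} (p : ℕ) (a : Adj n) where
  gammaP-≤ : ∀ {D} → Dominates p a D → gammaP p a ≤ ∣ D ∣
  gammaP-≤ {D} dom = minOver-≤ n (isPDom p a) ∣_∣ D (isPDom-complete p a D dom)

  ⊤-dominates : Dominates p a ⊤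
  ⊤-dominates x x∉⊤ = contradiction (trans (sym (lookup-replicate x true)) x∉⊤) λ ()

  gammaP-attained : ∃[ D ] Dominates p a D × gammaP p a ≡ ∣ D ∣
  gammaP-attained with minOver-attained n (isPDom p a) ∣_∣ ⊤ (isPDom-complete p a ⊤ ⊤-dominates)
  ... | D , D-dom , γ≡ = D , isPDom-sound p a D D-dom , γ≡

  gammaP≤n : gammaP p a ≤ n
  gammaP≤n = ≤-trans (gammaP-≤ ⊤-dominates) (≤-reflexive (∣⊤∣≡n n))

module _ {n} (p : ℕ) (a : Adj n) where
  private
    small : Subset n → Bool
    small X = suc ∣ X ∣ ≤ᵇ gammaP p a

    small⁺ : ∀ X → ∣ X ∣ < gammaP p a → small X ≡ true
    small⁺ X X<γ = Equivalence.to T-≡ (≤⇒≤ᵇ X<γ)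

  etaP-≤ : ∀ X → ∣ X ∣ < gammaP p a → etaP p a ≤ etaSum p a X
  etaP-≤ X X<γ = minOver-≤ (n * p) small (etaSum p a) X (small⁺ X X<γ)

  etaP-attained : 0 < gammaP p a → ∃[ X ] ∣ X ∣ < gammaP p a × etaP p a ≡ etaSum p a X
  etaP-attained 0<γ with minOver-attained (n * p) small (etaSum p a) ⊥ (small⁺ ⊥ (subst (_< gammaP p a) (sym (∣⊥∣≡0 n)) 0<γ))
  ... | X , X-small , η≡ = X , ≤ᵇ⇒≤ (suc ∣ X ∣) _ (Equivalence.from T-≡ X-small) , η≡

-- Counting edges of symmetric relations

SymAdj : ∀ {n} → Adj n → Set
SymAdj a = ∀ x y → a x y ≡ a y x

IrreflAdj : ∀ {n} → Adj n → Set
IrreflAdj a = ∀ x → a x x ≡ false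

_∪ₐ_ : ∀ {n} → Adj n → Adj n → Adj n
(a ∪ₐ b) u v = a u v ∨ b u v

∑∑-distrib-+ : ∀ {n} (f g : Fin n → Fin n → ℕ) →
  ∑[ x < n ] ∑[ y < n ] (f x y + g x y) ≡ ∑[ x < n ] ∑[ y < n ] f x y + ∑[ x < n ] ∑[ y < n ] g x y
∑∑-distrib-+ {n} f g = trans (sum-cong-≗ (λ x → ∑-distrib-+ (f x) (g x)))
  (∑-distrib-+ (λ x → ∑[ y < n ] f x y) (λ x → ∑[ y < n ] g x y))

countPairs : ∀ {n} → Adj n → Adj n → ℕ
countPairs {n} m c = ∑[ x < n ] ∑[ y < n ] ind (m x y ∧ c x y)

countPairs-∪ : ∀ {n} (m c d : Adj n) → countPairs m (c ∪ₐ d) ≤ countPairs m c + countPairs m d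
countPairs-∪ {n} m c d = begin
  countPairs m (c ∪ₐ d)
    ≤⟨ sum-mono (λ x → sum-mono (λ y → ind-∧-∨ (m x y) (c x y) (d x y))) ⟩
  ∑[ x < n ] ∑[ y < n ] (ind (m x y ∧ c x y) + ind (m x y ∧ d x y))
    ≡⟨ ∑∑-distrib-+ (λ x y → ind (m x y ∧ c x y)) (λ x y → ind (m x y ∧ d x y)) ⟩
  countPairs m c + countPairs m d ∎
  where
  open ≤-Reasoning
  ind-∧-∨ : ∀ t q r → ind (t ∧ (q ∨ r)) ≤ ind (t ∧ q) + ind (t ∧ r)
  ind-∧-∨ false q     r = z≤n
  ind-∧-∨ true  true  r = s≤s z≤n
  ind-∧-∨ true  false r = ≤-refl

anyPair : ∀ {n} → Adj n
anyPair _ _ = true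

ascending : ∀ {n} → Adj n
ascending x y = toℕ x <ᵇ toℕ y

pairs edges : ∀ {n} → Adj n → ℕ
pairs = countPairs anyPair
edges = countPairs ascending

edgeCount≡edges : ∀ {n} (b : Adj n) → edgeCount b ≡ edges b
edgeCount≡edges {n} b = begin
  edgeCount b
    ≡⟨ length-filterᵇ _ (cartesianProduct (allFin n) (allFin n)) ⟩
  sumˡ (map (λ (x , y) → ind (ascending x y ∧ b x y)) (cartesianProduct (allFin n) (allFin n)))
    ≡⟨ sumˡ-cartesianProduct (λ (x , y) → ind (ascending x y ∧ b x y)) (allFin n) (allFin n) ⟩
  sumˡ (map (λ x → sumˡ (map (λ y → ind (ascending x y ∧ b x y)) (allFin n))) (allFin n))
    ≡⟨ sumˡ-allFin (λ x → sumˡ (map (λ y → ind (ascending x y ∧ b x y)) (allFin n))) ⟩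
  ∑[ x < n ] sumˡ (map (λ y → ind (ascending x y ∧ b x y)) (allFin n))
    ≡⟨ sum-cong-≗ (λ x → sumˡ-allFin (λ y → ind (ascending x y ∧ b x y))) ⟩
  edges b ∎
  where open ≡-Reasoning

ascending-true : ∀ {n} {x y : Fin n} → toℕ x < toℕ y → ascending x y ≡ true
ascending-true x<y = Equivalence.to T-≡ (<⇒<ᵇ x<y)

ascending-false : ∀ {n} {x y : Fin n} → toℕ y ≤ toℕ x → ascending x y ≡ false
ascending-false {x = x} {y} y≤x with ascending x y in asc
... | false = refl
... | true  = contradiction (<ᵇ⇒< (toℕ x) (toℕ y) (Equivalence.from T-≡ asc)) (≤⇒≯ y≤x)

pairs≡2·edges : ∀ {n} (c : Adj n) → SymAdj c → IrreflAdj c → pairs c ≡ edges c + edges c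
pairs≡2·edges {n} c c-sym c-irr = begin
  ∑[ x < n ] ∑[ y < n ] ind (c x y)
    ≡⟨ sum-cong-≗ (λ x → sum-cong-≗ (λ y → one-orientation x y)) ⟩
  ∑[ x < n ] ∑[ y < n ] (up x y + up y x)
    ≡⟨ ∑∑-distrib-+ up (λ x y → up y x) ⟩
  edges c + ∑[ x < n ] ∑[ y < n ] up y x
    ≡⟨ cong (edges c +_) (∑-comm (λ x y → up y x)) ⟩
  edges c + edges c ∎
  where
  open ≡-Reasoning
  up : Fin n → Fin n → ℕ
  up x y = ind (ascending x y ∧ c x y)
  one-orientation : ∀ x y → ind (c x y) ≡ up x y + up y x
  one-orientation x y with <-cmp (toℕ x) (toℕ y)
  ... | tri< x<y _ _ rewrite ascending-true x<y | ascending-false {x = y} {x} (<⇒≤ x<y) =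
    sym (+-identityʳ _)
  ... | tri> _ _ y<x rewrite ascending-true y<x | ascending-false {x = x} {y} (<⇒≤ y<x) =
    cong ind (c-sym x y)
  ... | tri≈ _ x≡y _ rewrite toℕ-injective x≡y | c-irr y | ∧-zeroʳ (ascending y y) = refl

-- Halving an inequality, to pass from ordered pairs to edges.
m+m≤n+n⇒m≤n : ∀ {m n} → m + m ≤ n + n → m ≤ n
m+m≤n+n⇒m≤n {m} {n} m+m≤n+n with m ≤? n
... | yes m≤n = m≤n
... | no  m≰n = contradiction m+m≤n+n (<⇒≱ (+-mono-< (≰⇒> m≰n) (≰⇒> m≰n)))

leaving : ∀ {n} → Subset n → Adj n
leaving X x y = not (lookup X x) ∧ lookup X y

leaving-≤-edges : ∀ {n} (b : Adj n) → SymAdj b → IrreflAdj b → ∀ X →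
  countPairs (leaving X) b ≤ edges b
leaving-≤-edges {n} b b-sym b-irr X = m+m≤n+n⇒m≤n (begin
  out + out
    ≡⟨ cong (out +_) (∑-comm (λ x y → cross x y)) ⟩
  out + ∑[ x < n ] ∑[ y < n ] cross y x
    ≡⟨ sym (∑∑-distrib-+ cross (λ x y → cross y x)) ⟩
  ∑[ x < n ] ∑[ y < n ] (cross x y + cross y x)
    ≤⟨ sum-mono (λ x → sum-mono (λ y → one-direction x y)) ⟩
  pairs b
    ≡⟨ pairs≡2·edges b b-sym b-irr ⟩
  edges b + edges b ∎)
  where
  open ≤-Reasoning
  cross : Fin n → Fin n → ℕ
  cross x y = ind (leaving X x y ∧ b x y)
  out : ℕ
  out = countPairs (leaving X) b
  one-direction : ∀ x y → cross x y + cross y x ≤ ind (b x y)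
  one-direction x y rewrite b-sym y x with b x y | lookup X x | lookup X y
  ... | false | u     | v rewrite ∧-zeroʳ (not u ∧ v) | ∧-zeroʳ (not v ∧ u) = z≤n
  ... | true  | true  | true  = z≤n
  ... | true  | false | false = z≤n
  ... | true  | true  | false = ≤-refl
  ... | true  | false | true  = ≤-refl

point : ∀ {n} → Fin n → Fin n → Adj n
point x y u v = feq u x ∧ feq v y

edge : ∀ {n} → Fin n → Fin n → Adj n
edge x y = point x y ∪ₐ point y x

pairs-point : ∀ {n} (x y : Fin n) → pairs (point x y) ≡ 1
pairs-point {n} x y = trans (sum-cong-≗ row) (sum-δ x)
  where
  row : ∀ u → ∑[ v < n ] ind (feq u x ∧ feq v y) ≡ ind (feq u x)
  row u with feq u x
  ... | true  = sum-δ y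
  ... | false = sum-replicate-zero n

edge-sym : ∀ {n} (x y : Fin n) → SymAdj (edge x y)
edge-sym x y u v = trans (∨-comm (point x y u v) _) (cong₂ _∨_ (∧-comm (feq u y) _) (∧-comm (feq u x) _))

edge-irrefl : ∀ {n} {x y : Fin n} → x ≢ y → IrreflAdj (edge x y)
edge-irrefl {x = x} {y} x≢y u = cong₂ _∨_ (not-both x≢y) (not-both (x≢y ∘ sym))
  where
  not-both : ∀ {x y} → x ≢ y → feq u x ∧ feq u y ≡ false
  not-both {x} {y} x≢y with u ≟ x
  ... | no  _    = refl
  ... | yes refl = dec-false (u ≟ y) x≢y

edge-ends : ∀ {n} (x y u v : Fin n) → edge x y u v ≡ true → (u ≡ x × v ≡ y) ⊎ (u ≡ y × v ≡ x)
edge-ends x y u v e≡true =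
  Sum.map (witnesses x y) (witnesses y x) (Equivalence.to (T-∨ {point x y u v}) (Equivalence.from T-≡ e≡true))
  where
  witnesses : ∀ x y → T (point x y u v) → u ≡ x × v ≡ y
  witnesses x y t = let (tu , tv) = Equivalence.to (T-∧ {feq u x} {feq v y}) t in
    feq-sound (Equivalence.to T-≡ tu) , feq-sound (Equivalence.to T-≡ tv)

edges-edge : ∀ {n} {x y : Fin n} → x ≢ y → edges (edge x y) ≤ 1
edges-edge {x = x} {y} x≢y = m+m≤n+n⇒m≤n (begin
  edges (edge x y) + edges (edge x y)
    ≡⟨ sym (pairs≡2·edges (edge x y) (edge-sym x y) (edge-irrefl x≢y)) ⟩
  pairs (edge x y)
    ≤⟨ countPairs-∪ anyPair (point x y) (point y x) ⟩
  pairs (point x y) + pairs (point y x)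
    ≡⟨ cong₂ _+_ (pairs-point x y) (pairs-point y x) ⟩
  1 + 1 ∎)
  where open ≤-Reasoning

-- Degrees and deficiencies

_⊆_ : ∀ {n} → Subset n → Subset n → Set
X ⊆ Y = ∀ i → lookup X i ≡ true → lookup Y i ≡ true

_⊆ₐ_ : ∀ {n} → Adj n → Adj n → Set
a ⊆ₐ a' = ∀ x y → a x y ≡ true → a' x y ≡ true

ind-∧-mono : ∀ {b b' c c'} → (b ≡ true → b' ≡ true) → (c ≡ true → c' ≡ true) → ind (b ∧ c) ≤ ind (b' ∧ c')
ind-∧-mono {true} {_} {true} b⇒b' c⇒c' rewrite b⇒b' refl | c⇒c' refl = ≤-refl
ind-∧-mono {true} {_} {false} _ _ = z≤n
ind-∧-mono {false} _ _ = z≤n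

deg-mono : ∀ {n} {a a' : Adj n} {X Y} → a ⊆ₐ a' → X ⊆ Y → ∀ x → degIn a x X ≤ degIn a' x Y
deg-mono {a = a} {a'} {X} {Y} a⊆a' X⊆Y x = begin
  degIn a x X                              ≡⟨ deg-sum a x X ⟩
  ∑[ y < _ ] ind (a x y ∧ lookup X y)      ≤⟨ sum-mono (λ y → ind-∧-mono (a⊆a' x y) (X⊆Y y)) ⟩
  ∑[ y < _ ] ind (a' x y ∧ lookup Y y)     ≡⟨ deg-sum a' x Y ⟨
  degIn a' x Y ∎
  where open ≤-Reasoning

deg-mono-< : ∀ {n} {a a' : Adj n} {X x y} → a ⊆ₐ a' →
  lookup X y ≡ true → a x y ≡ false → a' x y ≡ true → degIn a x X < degIn a' x X
deg-mono-< {a = a} {a'} {X} {x} {y} a⊆a' y∈X ¬axy a'xy = begin-strict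
  degIn a x X                              ≡⟨ deg-sum a x X ⟩
  ∑[ y < _ ] ind (a x y ∧ lookup X y)      <⟨ sum-mono-< (λ y → ind-∧-mono (a⊆a' x y) id) y new ⟩
  ∑[ y < _ ] ind (a' x y ∧ lookup X y)     ≡⟨ deg-sum a' x X ⟨
  degIn a' x X ∎
  where
  open ≤-Reasoning
  new : ind (a x y ∧ lookup X y) < ind (a' x y ∧ lookup X y)
  new rewrite ¬axy | a'xy | y∈X = s≤s z≤n

non-neighbour : ∀ {n} (a : Adj n) x X → degIn a x X < ∣ X ∣ → ∃[ y ] lookup X y ≡ true × a x y ≡ false
non-neighbour a x X deg<∣X∣ with sum-<⇒∃ (λ y → ind (a x y ∧ lookup X y)) (λ y → ind (lookup X y))
                                       (subst₂ _<_ (deg-sum a x X) (card-sum X) deg<∣X∣)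
... | y , fewer with a x y in axy | lookup X y in y∈X
... | false | true = y , y∈X , axy
... | true  | true = contradiction fewer (<-irrefl refl)

etaPt-outside : ∀ {n} p (a : Adj n) {x} X → lookup X x ≡ false → etaPt p a x X ≡ p ∸ degIn a x X
etaPt-outside p a {x} X x∉X with lookup X x
etaPt-outside p a {x} X refl | false = refl

etaPt-antitone : ∀ {n} p {a a' : Adj n} {X Y} → a ⊆ₐ a' → X ⊆ Y → ∀ x → etaPt p a' x Y ≤ etaPt p a x X
etaPt-antitone p {a} {a'} {X} {Y} a⊆a' X⊆Y x with lookup Y x in x∈?Y | lookup X x in x∈?X
... | true  | _     = z≤n
... | false | false = ∸-monoʳ-≤ p (deg-mono a⊆a' X⊆Y x)
... | false | true  = contradiction (trans (sym x∈?Y) (X⊆Y x x∈?X)) λ ()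

etaSum-antitone : ∀ {n} p {a a' : Adj n} {X Y} → a ⊆ₐ a' → X ⊆ Y → etaSum p a' Y ≤ etaSum p a X
etaSum-antitone p {a} {a'} {X} {Y} a⊆a' X⊆Y = begin
  etaSum p a' Y                ≡⟨ etaSum-sum p a' Y ⟩
  ∑[ x < _ ] etaPt p a' x Y    ≤⟨ sum-mono (etaPt-antitone p a⊆a' X⊆Y) ⟩
  ∑[ x < _ ] etaPt p a x X     ≡⟨ etaSum-sum p a X ⟨
  etaSum p a X ∎
  where open ≤-Reasoning

etaSum≡0⇒Dominates : ∀ {n} p (a : Adj n) X → etaSum p a X ≡ 0 → Dominates p a X
etaSum≡0⇒Dominates p a X η≡0 x x∉X = m∸n≡0⇒m≤n (n≤0⇒n≡0 (begin
  p ∸ degIn a x X             ≡⟨ etaPt-outside p a X x∉X ⟨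
  etaPt p a x X               ≤⟨ summand≤sum (λ z → etaPt p a z X) x ⟩
  ∑[ z < _ ] etaPt p a z X    ≡⟨ trans (sym (etaSum-sum p a X)) η≡0 ⟩
  0 ∎))
  where open ≤-Reasoning

Dominates-mono : ∀ {n} p {a a' : Adj n} {X} → a ⊆ₐ a' → Dominates p a X → Dominates p a' X
Dominates-mono p a⊆a' dom x x∉X = ≤-trans (dom x x∉X) (deg-mono a⊆a' (λ _ → id) x)

-- Lower bound: a reinforcing set has at least η_p(G) edges

∪ₐ-upperˡ : ∀ {n} (a b : Adj n) → a ⊆ₐ (a ∪ₐ b)
∪ₐ-upperˡ a b x y axy = cong (_∨ b x y) axy

-- If X is p-dominating in a ∪ b, then b has to supply, for every x ∉ X, the
-- missing η_p(x,X) neighbours in X.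
etaSum-≤-leaving : ∀ {n} p (a b : Adj n) X → Dominates p (a ∪ₐ b) X → etaSum p a X ≤ countPairs (leaving X) b
etaSum-≤-leaving {n} p a b X dom = ≤-trans (≤-reflexive (etaSum-sum p a X)) (sum-mono covered)
  where
  covered : ∀ x → etaPt p a x X ≤ ∑[ y < n ] ind (leaving X x y ∧ b x y)
  covered x with lookup X x in x∈?X
  ... | true  = z≤n
  ... | false = m≤n+o⇒m∸n≤o p (degIn a x X) (begin
    p                                                    ≤⟨ dom x x∈?X ⟩
    degIn (a ∪ₐ b) x X                                   ≡⟨ deg-sum (a ∪ₐ b) x X ⟩
    ∑[ y < n ] ind ((a x y ∨ b x y) ∧ lookup X y)         ≤⟨ sum-mono (λ y → split (a x y) (b x y) (lookup X y)) ⟩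
    ∑[ y < n ] (ind (a x y ∧ lookup X y) + ind (lookup X y ∧ b x y))
                                                         ≡⟨ ∑-distrib-+ (λ y → ind (a x y ∧ lookup X y)) _ ⟩
    ∑[ y < n ] ind (a x y ∧ lookup X y) + ∑[ y < n ] ind (lookup X y ∧ b x y)
                                                         ≡⟨ cong (_+ _) (deg-sum a x X) ⟨
    degIn a x X + ∑[ y < n ] ind (lookup X y ∧ b x y) ∎)
    where
    open ≤-Reasoning
    split : ∀ r s t → ind ((r ∨ s) ∧ t) ≤ ind (r ∧ t) + ind (t ∧ s)
    split true  s     true  = s≤s z≤n
    split false true  true  = ≤-refl
    split false false true  = z≤n
    split r     s     false rewrite ∧-zeroʳ (r ∨ s) = z≤n

reinforcement-lower-bound : ∀ {n} (G : Graph n) p (B : NonEdgeSet G) → Reinforces p G B →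
  etaP p (adj G) ≤ edgeCount (badj B)
reinforcement-lower-bound G p B reinforces with gammaP-attained p (plus G B)
... | D , D-dom , γ⁺≡∣D∣ = begin
  etaP p (adj G)                      ≤⟨ etaP-≤ p (adj G) D (subst (_< gammaP p (adj G)) γ⁺≡∣D∣ reinforces) ⟩
  etaSum p (adj G) D                  ≤⟨ etaSum-≤-leaving p (adj G) (badj B) D D-dom ⟩
  countPairs (leaving D) (badj B)     ≤⟨ leaving-≤-edges (badj B) (bsym B) (birrefl B) D ⟩
  edges (badj B)                      ≡⟨ edgeCount≡edges (badj B) ⟨
  edgeCount (badj B) ∎
  where open ≤-Reasoning

-- Upper bound: completing a set of size ≥ p to a p-dominating one

record Completion {n} (p : ℕ) (a : Adj n) (X : Subset n) : Set where
  field
    added        : Adj n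
    added-sym    : SymAdj added
    added-irrefl : IrreflAdj added
    added-new    : ∀ x y → added x y ≡ true → a x y ≡ false
    added-size   : edges added ≤ etaSum p a X
    dominating   : Dominates p (a ∪ₐ added) X

empty-completion : ∀ {n} p (a : Adj n) X → etaSum p a X ≡ 0 → Completion p a X
empty-completion {n} p a X η≡0 = record
  { added        = λ _ _ → false
  ; added-sym    = λ _ _ → refl
  ; added-irrefl = λ _ → refl
  ; added-new    = λ _ _ ()
  ; added-size   = ≤-reflexive (trans no-edges (sym η≡0))
  ; dominating   = Dominates-mono p (∪ₐ-upperˡ a _) (etaSum≡0⇒Dominates p a X η≡0)
  }
  where
  no-edges : edges {n} (λ _ _ → false) ≡ 0
  no-edges = trans (sum-cong-≗ row) (sum-replicate-zero n)
    where
    row : ∀ x → ∑[ y < n ] ind (ascending x y ∧ false) ≡ 0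
    row x = trans (sum-cong-≗ (λ y → cong ind (∧-zeroʳ (ascending x y)))) (sum-replicate-zero n)

grow-completion : ∀ {n} p {a : Adj n} {X x y} → SymAdj a → x ≢ y → a x y ≡ false →
  etaSum p (a ∪ₐ edge x y) X < etaSum p a X → Completion p (a ∪ₐ edge x y) X → Completion p a X
grow-completion {n} p {a} {X} {x} {y} a-sym x≢y ¬axy drop C = record
  { added        = b ∪ₐ edge x y
  ; added-sym    = λ u v → cong₂ _∨_ (added-sym u v) (edge-sym x y u v)
  ; added-irrefl = λ u → cong₂ _∨_ (added-irrefl u) (edge-irrefl x≢y u)
  ; added-new    = new
  ; added-size   = begin
      edges (b ∪ₐ edge x y)                 ≤⟨ countPairs-∪ ascending b (edge x y) ⟩
      edges b + edges (edge x y)            ≤⟨ +-mono-≤ added-size (edges-edge x≢y) ⟩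
      etaSum p (a ∪ₐ edge x y) X + 1        ≡⟨ +-comm _ 1 ⟩
      suc (etaSum p (a ∪ₐ edge x y) X)      ≤⟨ drop ⟩
      etaSum p a X ∎
  ; dominating   = Dominates-mono p regroup dominating
  }
  where
  open Completion C
  open ≤-Reasoning
  b : Adj n
  b = added
  new : ∀ u v → (b ∪ₐ edge x y) u v ≡ true → a u v ≡ false
  new u v buv with b u v in b-uv
  ... | true  = ∨-false-left (added-new u v b-uv)
    where
    ∨-false-left : ∀ {r s} → r ∨ s ≡ false → r ≡ false
    ∨-false-left {false} _ = refl
  ... | false with edge-ends x y u v buv
  ... | inj₁ (refl , refl) = ¬axy
  ... | inj₂ (refl , refl) = trans (a-sym y x) ¬axy
  regroup : ((a ∪ₐ edge x y) ∪ₐ b) ⊆ₐ (a ∪ₐ (b ∪ₐ edge x y))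
  regroup u v h = trans (trans (cong (a u v ∨_) (∨-comm (b u v) (edge x y u v)))
                               (sym (∨-assoc (a u v) (edge x y u v) (b u v)))) h

etaSum-add-edge-< : ∀ {n} p (a : Adj n) {X x y} → lookup X x ≡ false → lookup X y ≡ true → a x y ≡ false →
  degIn a x X < p → etaSum p (a ∪ₐ edge x y) X < etaSum p a X
etaSum-add-edge-< {n} p a {X} {x} {y} x∉X y∈X ¬axy deg<p = begin-strict
  etaSum p (a ∪ₐ edge x y) X            ≡⟨ etaSum-sum p (a ∪ₐ edge x y) X ⟩
  ∑[ z < n ] etaPt p (a ∪ₐ edge x y) z X <⟨ sum-mono-< (etaPt-antitone p (∪ₐ-upperˡ a (edge x y)) (λ _ → id)) x at-x ⟩
  ∑[ z < n ] etaPt p a z X              ≡⟨ etaSum-sum p a X ⟨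
  etaSum p a X ∎
  where
  open ≤-Reasoning
  joined : (a ∪ₐ edge x y) x y ≡ true
  joined rewrite dec-true (x ≟ x) refl | dec-true (y ≟ y) refl = ∨-zeroʳ (a x y)
  at-x : etaPt p (a ∪ₐ edge x y) x X < etaPt p a x X
  at-x = begin-strict
    etaPt p (a ∪ₐ edge x y) x X     ≡⟨ etaPt-outside p (a ∪ₐ edge x y) X x∉X ⟩
    p ∸ degIn (a ∪ₐ edge x y) x X   ≤⟨ ∸-monoʳ-≤ p (deg-mono-< (∪ₐ-upperˡ a (edge x y)) y∈X ¬axy joined) ⟩
    p ∸ suc (degIn a x X)           <⟨ ∸-monoʳ-< ≤-refl deg<p ⟩
    p ∸ degIn a x X                 ≡⟨ etaPt-outside p a X x∉X ⟨
    etaPt p a x X ∎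

deficient-vertex : ∀ {n} p (a : Adj n) X → 0 < etaSum p a X → ∃[ x ] lookup X x ≡ false × degIn a x X < p
deficient-vertex {n} p a X 0<η
  with sum-<⇒∃ (λ _ → 0) (λ x → etaPt p a x X)
         (subst₂ _<_ (sym (sum-replicate-zero n)) (etaSum-sum p a X) 0<η)
... | x , 0<ηx with lookup X x in x∈?X
... | false = x , x∈?X , m∸n≢0⇒n<m (n>0⇒n≢0 0<ηx)

-- If p ≤ |X|, every X has a completion: repeatedly join a deficient vertex to a
-- non-neighbour in X, by induction on a bound k for the deficiency.
complete : ∀ {n} p (X : Subset n) → p ≤ ∣ X ∣ → ∀ k (a : Adj n) → SymAdj a → etaSum p a X ≤ k → Completion p a X
complete p X p≤∣X∣ zero    a a-sym η≤0 = empty-completion p a X (n≤0⇒n≡0 η≤0)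
complete p X p≤∣X∣ (suc k) a a-sym η≤1+k with etaSum p a X in η≡
... | zero  = empty-completion p a X η≡
... | suc _ with deficient-vertex p a X (subst (0 <_) (sym η≡) z<s)
... | x , x∉X , deg<p with non-neighbour a x X (<-≤-trans deg<p p≤∣X∣)
... | y , y∈X , ¬axy =
  grow-completion p a-sym x≢y ¬axy drop
    (complete p X p≤∣X∣ k (a ∪ₐ edge x y) a⁺-sym (s≤s⁻¹ (≤-trans drop (≤-trans (≤-reflexive η≡) η≤1+k))))
  where
  x≢y : x ≢ y
  x≢y refl = contradiction (trans (sym x∉X) y∈X) λ ()
  drop : etaSum p (a ∪ₐ edge x y) X < etaSum p a X
  drop = etaSum-add-edge-< p a x∉X y∈X ¬axy deg<p
  a⁺-sym : SymAdj (a ∪ₐ edge x y)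
  a⁺-sym u v = cong₂ _∨_ (a-sym u v) (edge-sym x y u v)

enlarge : ∀ {n} (X : Subset n) m → ∣ X ∣ ≤ m → m ≤ n → ∃[ Y ] X ⊆ Y × ∣ Y ∣ ≡ m
enlarge [] zero _ _ = [] , (λ ()) , refl
enlarge (true ∷ X) (suc m) (s≤s ∣X∣≤m) (s≤s m≤n) with enlarge X m ∣X∣≤m m≤n
... | Y , X⊆Y , ∣Y∣≡m = true ∷ Y , (λ { zero _ → refl ; (suc i) → X⊆Y i }) , cong suc ∣Y∣≡m
enlarge {suc n} (false ∷ X) m ∣X∣≤m m≤1+n with m ≤? n
... | yes m≤n with enlarge X m ∣X∣≤m m≤n
...   | Y , X⊆Y , ∣Y∣≡m = false ∷ Y , (λ { (suc i) → X⊆Y i }) , ∣Y∣≡m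
enlarge {suc n} (false ∷ X) m ∣X∣≤m m≤1+n | no m≰n with enlarge X n (∣p∣≤n X) ≤-refl
...   | Y , X⊆Y , ∣Y∣≡n = true ∷ Y , (λ { (suc i) → X⊆Y i }) , trans (cong suc ∣Y∣≡n) (≤-antisym (≰⇒> m≰n) m≤1+n)

-- For p < γ_p, there is a set X with p ≤ |X| < γ_p whose deficiency is at most η_p:
-- enlarge a set attaining η_p to size max(p, |X₀|).
target-set : ∀ {n} p (a : Adj n) → p < gammaP p a →
  ∃[ X ] p ≤ ∣ X ∣ × ∣ X ∣ < gammaP p a × etaSum p a X ≤ etaP p a
target-set p a p<γ with etaP-attained p a (<-≤-trans z<s p<γ)
... | X₀ , X₀<γ , η≡ with enlarge X₀ (p ⊔ ∣ X₀ ∣) (m≤n⊔m p ∣ X₀ ∣) (≤-trans (<⇒≤ (⊔-lub p<γ X₀<γ)) (gammaP≤n p a))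
... | X , X₀⊆X , ∣X∣≡max =
  X , subst (p ≤_) (sym ∣X∣≡max) (m≤m⊔n p ∣ X₀ ∣)
    , subst (_< gammaP p a) (sym ∣X∣≡max) (⊔-lub p<γ X₀<γ)
    , ≤-trans (etaSum-antitone p (λ _ _ → id) X₀⊆X) (≤-reflexive (sym η≡))

reinforce-through : ∀ {n} (G : Graph n) p X → p ≤ ∣ X ∣ → ∣ X ∣ < gammaP p (adj G) →
  Σ (NonEdgeSet G) λ B → Reinforces p G B × edgeCount (badj B) ≤ etaSum p (adj G) X
reinforce-through G p X p≤∣X∣ X<γ = B , reinforces , size
  where
  C : Completion p (adj G) X
  C = complete p X p≤∣X∣ (etaSum p (adj G) X) (adj G) (Graph.sym G) ≤-refl
  open Completion C
  B : NonEdgeSet G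
  B = record { badj = added ; bsym = added-sym ; birrefl = added-irrefl ; disjoint = added-new }
  reinforces : Reinforces p G B
  reinforces = ≤-<-trans (gammaP-≤ p (plus G B) {X} dominating) X<γ
  size : edgeCount added ≤ etaSum p (adj G) X
  size = ≤-trans (≤-reflexive (edgeCount≡edges added)) added-size

-- r_p(G) = η_p(G) whenever γ_p(G) > p.
theorem2p2 : ∀ {n} (G : Graph n) (p : ℕ) → 0 < p → HasEdge G →
    p < gammaP p (adj G) → IsReinforcementNumber p G (etaP p (adj G))
theorem2p2 G p _ _ p<γ =
  let X , p≤∣X∣ , X<γ , ηX≤η     = target-set p (adj G) p<γ
      B , reinforces , |B|≤ηX = reinforce-through G p X p≤∣X∣ X<γ
      |B|≤η                  = ≤-trans |B|≤ηX ηX≤η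
  in (B , reinforces , ≤-antisym |B|≤η (reinforcement-lower-bound G p B reinforces))
     , reinforcement-lower-bound G p
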